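{- For every integer $n\ge0$, the misère monoid $\mathcal{M}_{\mathrm{cl}(\mathsf{L}(\tau^{2n+1}))}$ has exactly four elements, namely the equivalence classes of $0$, $*$, $*+*$ and $\mathsf{L}(\tau^{2n+1})$.
   Context: A position $\xi=\{\xi^L \mid \xi^R\}$ is given recursively by finite sets of Left and Right options; $\cdot$ denotes an empty set. $0=\{\cdot\mid\cdot\}$, $*=\{0\mid0\}$, $\tau^0=*$, $\tau^k=\{\tau^{k-1}\mid\tau^{k-1}\}$ for $k\ge1$, and $\mathsf{L}(\xi)=\{\xi\mid\cdot\}$. Disjunctive sum: $\alpha+\beta=\{\alpha^L+\beta,\alpha+\beta^L \mid \alpha^R+\beta,\alpha+\beta^R\}$. Under misère play a player unable to move on their turn wins; $o^-$ denotes misère outcome ($\mathcal{L}$, $\mathcal{R}$, $\mathcal{N}$ next player wins, $\mathcal{P}$ next player loses). $\mathrm{cl}(\xi)$ is the smallest set containing $\xi$ closed under disjunctive sum and taking options. For closed $\Gamma$, $\alpha\equiv\beta\pmod\Gamma$ iff $o^-(\alpha+\gamma)=o^-(\beta+\gamma)$ for all $\gamma\in\Gamma$; the misère monoid $\mathcal{M}_\Gamma$ is the set of $\equiv$-classes with the monoid operation induced by disjunctive sum. -}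

module Defs where

open import Data.Nat using (ℕ; zero; suc; _+_)
open import Data.Fin using (Fin; splitAt)
open import Data.Bool using (Bool; true; false; _∨_; _∧_; not)
open import Data.Sum using (_⊎_; inj₁; inj₂; [_,_]′)
open import Relation.Binary.PropositionalEquality using (_≡_)

data Game : Set where
  mk : (nL : ℕ) → (Fin nL → Game) → (nR : ℕ) → (Fin nR → Game) → Game

nLeft : Game → ℕ
nLeft (mk nL _ _ _) = nL

nRight : Game → ℕ
nRight (mk _ _ nR _) = nR

leftOpt : (g : Game) → Fin (nLeft g) → Game
leftOpt (mk _ gL _ _) = gL

rightOpt : (g : Game) → Fin (nRight g) → Game
rightOpt (mk _ _ _ gR) = gR

zeroG : Game
zeroG = mk 0 (λ ()) 0 (λ ())

star : Game
star = mk 1 (λ _ → zeroG) 1 (λ _ → zeroG)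

tau : ℕ → Game
tau zero = star
tau (suc k) = mk 1 (λ _ → tau k) 1 (λ _ → tau k)

LG : Game → Game
LG ξ = mk 1 (λ _ → ξ) 0 (λ ())

-- Disjunctive sum α + β = {α^L+β, α+β^L | α^R+β, α+β^R}
infixl 6 _⊕_
_⊕_ : Game → Game → Game
mk aL fL aR fR ⊕ mk bL gL bR gR =
  mk (aL + bL)
     (λ i → [ (λ j → fL j ⊕ mk bL gL bR gR) , (λ j → mk aL fL aR fR ⊕ gL j) ]′ (splitAt aL i))
     (aR + bR)
     (λ i → [ (λ j → fR j ⊕ mk bL gL bR gR) , (λ j → mk aL fL aR fR ⊕ gR j) ]′ (splitAt aR i))

anyF : (n : ℕ) → (Fin n → Bool) → Bool
anyF zero f = false
anyF (suc n) f = f Fin.zero ∨ anyF n (λ i → f (Fin.suc i))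

isZero : ℕ → Bool
isZero zero = true
isZero (suc _) = false

-- Misère play: a player unable to move on their turn wins.
-- leftFirst g  : Left, moving first in g, wins.
-- leftSecond g : Left, moving second in g (Right to move), wins.
mutual
  leftFirst : Game → Bool
  leftFirst (mk nL gL nR gR) = isZero nL ∨ anyF nL (λ i → leftSecond (gL i))

  leftSecond : Game → Bool
  leftSecond (mk nL gL nR gR) = not (isZero nR) ∧ not (anyF nR (λ i → not (leftFirst (gR i))))

mutual
  rightFirst : Game → Bool
  rightFirst (mk nL gL nR gR) = isZero nR ∨ anyF nR (λ i → rightSecond (gR i))

  rightSecond : Game → Bool
  rightSecond (mk nL gL nR gR) = not (isZero nL) ∧ not (anyF nL (λ i → not (rightFirst (gL i))))

data Outcome : Set where
  𝓛 𝓡 𝓝 𝓟 : Outcome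

outcome : Game → Outcome
outcome g with leftFirst g | rightFirst g
... | true  | true  = 𝓝
... | true  | false = 𝓛
... | false | true  = 𝓡
... | false | false = 𝓟

data Cl (ξ : Game) : Game → Set where
  base  : Cl ξ ξ
  sumC  : ∀ {a b} → Cl ξ a → Cl ξ b → Cl ξ (a ⊕ b)
  leftC : ∀ {g} → Cl ξ g → (i : Fin (nLeft g)) → Cl ξ (leftOpt g i)
  rightC : ∀ {g} → Cl ξ g → (i : Fin (nRight g)) → Cl ξ (rightOpt g i)

Equiv : (Game → Set) → Game → Game → Set
Equiv Γ α β = ∀ γ → Γ γ → outcome (α ⊕ γ) ≡ outcome (β ⊕ γ)

module Submission where

-- Let ξ = L(τ^k) and m = k + 1, the number of moves in τ^k.
-- Every position of cl(ξ) behaves like a canonical position (a, N): a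
-- untouched copies of ξ plus a pool of N neutral moves.  Either player may
-- use a neutral move (N decreases), and Left may also unlock a copy of ξ,
-- turning it into τ^k (a decreases, N grows by m).  The relation
-- Profile g a N expresses this; it is inherited by options and by sums.
-- Each move shortens len a N = a·(m+1) + N by one, Left can move iff
-- len > 0 and Right iff N > 0, so misère play on canonical positions is
-- solved by the signature (len even?, N = 0?).  Signatures of sums combine
-- in a four-element monoid, so equal signatures give equivalence modulo
-- cl(ξ).  For k odd, ξ has odd length and the outcomes against the probes 0
-- and ξ recover the signature, so different signatures are distinguished.
-- The representatives 0, *, *+*, ξ realise the four signatures.

open import Defs
open import Data.Nat using (ℕ; zero; suc; _+_; _*_)
open import Data.Nat.Properties using (+-suc; +-assoc; +-identityʳ)
open import Data.Nat.Tactic.RingSolver using (solve-∀)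
open import Data.Bool using (Bool; true; false; not; _∧_; _∨_; _xor_)
open import Data.Bool.Properties
  using (not-involutive; not-injective; not-distribˡ-xor; xor-identityʳ; xor-inverseˡ; ∨-zeroʳ; ∧-zeroʳ)
open import Data.Fin using (Fin; splitAt; _↑ˡ_; _↑ʳ_)
open import Data.Vec.Functional using (_++_)
open import Data.Vec.Functional.Properties using (lookup-++ˡ; lookup-++ʳ)
open import Data.Product using (Σ-syntax; _×_; _,_; map₂)
open import Data.Sum using (_⊎_; inj₁; inj₂; [_,_])
open import Relation.Nullary using (¬_)
open import Relation.Binary.PropositionalEquality
  using (_≡_; _≢_; refl; sym; trans; cong; cong₂; subst; subst₂; module ≡-Reasoning)

even : ℕ → Bool
even zero    = true
even (suc n) = not (even n)

even-+ : ∀ x y → even (x + y) ≡ not (even x) xor even y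
even-+ zero    y = refl
even-+ (suc x) y = trans (cong not (even-+ x y)) (not-distribˡ-xor (not (even x)) (even y))

even-2n+1 : ∀ n → even (2 * n + 1) ≡ false
even-2n+1 n = begin
  even (2 * n + 1)              ≡⟨ even-+ (2 * n) 1 ⟩
  not (even (2 * n)) xor false  ≡⟨ xor-identityʳ _ ⟩
  not (even (n + (n + 0)))      ≡⟨ cong (λ x → not (even (n + x))) (+-identityʳ n) ⟩
  not (even (n + n))            ≡⟨ cong not (even-+ n n) ⟩
  not (not (even n) xor even n) ≡⟨ cong not (xor-inverseˡ (even n)) ⟩
  false                         ∎
  where open ≡-Reasoning

isZero-+ : ∀ N K → isZero (N + K) ≡ isZero N ∧ isZero K
isZero-+ zero    K = refl
isZero-+ (suc N) K = refl

+-rotate : ∀ x y z → (x + y) + z ≡ y + (z + x)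
+-rotate = solve-∀

+-swapʳ : ∀ x y z → (x + y) + z ≡ (x + z) + y
+-swapʳ = solve-∀

*+-interchange : ∀ a b x N K → (a + b) * x + (N + K) ≡ (a * x + N) + (b * x + K)
*+-interchange = solve-∀

anyF-intro : ∀ n (f : Fin n → Bool) i → f i ≡ true → anyF n f ≡ true
anyF-intro (suc n) f Fin.zero    fi = cong (_∨ anyF n (λ j → f (Fin.suc j))) fi
anyF-intro (suc n) f (Fin.suc i) fi =
  trans (cong (f Fin.zero ∨_) (anyF-intro n (λ j → f (Fin.suc j)) i fi)) (∨-zeroʳ (f Fin.zero))

anyF-false : ∀ n (f : Fin n → Bool) → (∀ i → f i ≡ false) → anyF n f ≡ false
anyF-false zero    f all = refl
anyF-false (suc n) f all =
  cong₂ _∨_ (all Fin.zero) (anyF-false n (λ j → f (Fin.suc j)) (λ j → all (Fin.suc j)))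

anyF-const : ∀ n (f : Fin (suc n) → Bool) b → (∀ i → f i ≡ b) → anyF (suc n) f ≡ b
anyF-const n f true  all = anyF-intro (suc n) f Fin.zero (all Fin.zero)
anyF-const n f false all = anyF-false (suc n) f all

-- The options of a sum are the concatenation of two families (Defs._⊕_);
-- properties of all or of some options transfer through the concatenation.
all-++ : ∀ {A : Set} {m n} (P : A → Set) (f : Fin m → A) (g : Fin n → A) →
         (∀ j → P (f j)) → (∀ j → P (g j)) → ∀ i → P ((f ++ g) i)
all-++ {m = m} P f g pf pg i = [_,_] {C = λ s → P ([ f , g ] s)} pf pg (splitAt m i)

any-++ˡ : ∀ {A : Set} {m n} (P : A → Set) (f : Fin m → A) (g : Fin n → A) →
          Σ[ j ∈ Fin m ] P (f j) → Σ[ i ∈ Fin (m + n) ] P ((f ++ g) i)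
any-++ˡ {n = n} P f g (j , p) = j ↑ˡ n , subst P (sym (lookup-++ˡ f g j)) p

any-++ʳ : ∀ {A : Set} {m n} (P : A → Set) (f : Fin m → A) (g : Fin n → A) →
          Σ[ j ∈ Fin n ] P (g j) → Σ[ i ∈ Fin (m + n) ] P ((f ++ g) i)
any-++ʳ {m = m} P f g (j , p) = m ↑ʳ j , subst P (sym (lookup-++ʳ f g j)) p

outcomeOf : Bool → Bool → Outcome
outcomeOf true  true  = 𝓝
outcomeOf true  false = 𝓛
outcomeOf false true  = 𝓡
outcomeOf false false = 𝓟

outcome-decomposes : ∀ g → outcome g ≡ outcomeOf (leftFirst g) (rightFirst g)
outcome-decomposes g with leftFirst g | rightFirst g
... | true  | true  = refl
... | true  | false = refl
... | false | true  = refl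
... | false | false = refl

-- A signature records (is the canonical length even?, is Right out of moves?).
-- Signatures of sums combine by _⊞_, and determine the outcome.
Signature : Set
Signature = Bool × Bool

_⊞_ : Signature → Signature → Signature
(e , z) ⊞ (e′ , z′) = not e xor e′ , z ∧ z′

canonicalOutcome : Signature → Outcome
canonicalOutcome (e , z) = outcomeOf e (z ∨ e)

-- The outcomes after adding the probes 0 (signature (true , true)) and an
-- odd-length ξ (signature (false , true)) recover the signature.
decode : Outcome → Outcome → Signature
decode 𝓝 𝓡 = true , true
decode 𝓝 _ = true , false
decode 𝓡 _ = false , true
decode _ _ = false , false

decode-probes : ∀ s →
  decode (canonicalOutcome (s ⊞ (true , true))) (canonicalOutcome (s ⊞ (false , true))) ≡ s
decode-probes (true  , true)  = refl
decode-probes (true  , false) = refl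
decode-probes (false , true)  = refl
decode-probes (false , false) = refl

module CanonicalForm (k : ℕ) where

  -- m is the number of moves in τ^k; ξ itself lasts m + 1 moves.
  m : ℕ
  m = suc k

  ξ : Game
  ξ = LG (tau k)

  -- Total length of the canonical position with a copies of ξ and N neutral moves.
  len : ℕ → ℕ → ℕ
  len a N = a * suc m + N

  len-neutral : ∀ a N → len a (suc N) ≡ suc (len a N)
  len-neutral a N = +-suc (a * suc m) N

  len-unlock : ∀ a N → len (suc a) N ≡ suc (len a (N + m))
  len-unlock a N = cong suc (+-rotate m (a * suc m) N)

  len-⊕ : ∀ a b N K → len (a + b) (N + K) ≡ len a N + len b K
  len-⊕ a b N K = *+-interchange a b (suc m) N K

  -- Profile g a N: g behaves like the canonical position (a, N).  Every
  -- option of g is an option of the canonical position, and every option of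
  -- the canonical position is realised by some option of g.
  mutual
    data Profile : Game → ℕ → ℕ → Set where
      profile : ∀ {nL gL nR gR a N} →
        (∀ i → LeftStep (gL i) a N) →
        (∀ i → RightStep (gR i) a N) →
        (∀ {a′} → a ≡ suc a′ → Σ[ i ∈ Fin nL ] Profile (gL i) a′ (N + m)) →
        (∀ {N′} → N ≡ suc N′ → Σ[ i ∈ Fin nL ] Profile (gL i) a N′) →
        (∀ {N′} → N ≡ suc N′ → Σ[ i ∈ Fin nR ] Profile (gR i) a N′) →
        Profile (mk nL gL nR gR) a N

    data LeftStep (h : Game) : ℕ → ℕ → Set where
      neutral : ∀ {a N} → Profile h a N → LeftStep h a (suc N)
      unlock  : ∀ {a N} → Profile h a (N + m) → LeftStep h (suc a) N

    data RightStep (h : Game) : ℕ → ℕ → Set where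
      neutral : ∀ {a N} → Profile h a N → RightStep h a (suc N)

  right-step-profile : ∀ {h a N} → RightStep h a (suc N) → Profile h a N
  right-step-profile (neutral p) = p

  left-step-length : ∀ {h a N} → LeftStep h a N →
                     Σ[ a′ ∈ ℕ ] Σ[ N′ ∈ ℕ ] Profile h a′ N′ × len a N ≡ suc (len a′ N′)
  left-step-length (neutral {a} {N} p) = a , N , p , len-neutral a N
  left-step-length (unlock {a} {N} p)  = a , N + m , p , len-unlock a N

  profile-0 : Profile zeroG 0 0
  profile-0 = profile (λ ()) (λ ()) (λ ()) (λ ()) (λ ())

  profile-switch : ∀ {g N} → Profile g 0 N → Profile (mk 1 (λ _ → g) 1 (λ _ → g)) 0 (suc N)
  profile-switch p =
    profile (λ _ → neutral p) (λ _ → neutral p) (λ ())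
            (λ { refl → Fin.zero , p }) (λ { refl → Fin.zero , p })

  profile-tau : ∀ j → Profile (tau j) 0 (suc j)
  profile-tau zero    = profile-switch profile-0
  profile-tau (suc j) = profile-switch (profile-tau j)

  profile-ξ : Profile ξ 1 0
  profile-ξ =
    profile (λ _ → unlock (profile-tau k)) (λ ()) (λ { refl → Fin.zero , profile-tau k }) (λ ()) (λ ())

  mutual
    profile-⊕ : ∀ {g h a b N K} → Profile g a N → Profile h b K → Profile (g ⊕ h) (a + b) (N + K)
    profile-⊕ {a = a} {b} {N} {K} pg@(profile gLeft gRight _ _ _) ph@(profile hLeft hRight _ _ _) =
      profile (all-++ (λ x → LeftStep x (a + b) (N + K)) _ _
                      (λ j → left-step-⊕ˡ (gLeft j) ph) (λ j → left-step-⊕ʳ pg (hLeft j)))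
              (all-++ (λ x → RightStep x (a + b) (N + K)) _ _
                      (λ j → right-step-⊕ˡ (gRight j) ph) (λ j → right-step-⊕ʳ pg (hRight j)))
              (unlock-⊕ pg ph) (neutral-left-⊕ pg ph) (neutral-right-⊕ pg ph)

    left-step-⊕ˡ : ∀ {g h a b N K} → LeftStep g a N → Profile h b K → LeftStep (g ⊕ h) (a + b) (N + K)
    left-step-⊕ˡ (neutral p) q = neutral (profile-⊕ p q)
    left-step-⊕ˡ (unlock {N = N} p) q = unlock (subst (Profile _ _) (+-swapʳ N m _) (profile-⊕ p q))

    left-step-⊕ʳ : ∀ {g h a b N K} → Profile g a N → LeftStep h b K → LeftStep (g ⊕ h) (a + b) (N + K)
    left-step-⊕ʳ {N = N} p (neutral {N = K} q) =
      subst (LeftStep _ _) (sym (+-suc N K)) (neutral (profile-⊕ p q))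
    left-step-⊕ʳ {a = a} {N = N} p (unlock {a = b} {N = K} q) =
      subst₂ (LeftStep _) (sym (+-suc a b)) refl
             (unlock (subst (Profile _ _) (sym (+-assoc N K m)) (profile-⊕ p q)))

    right-step-⊕ˡ : ∀ {g h a b N K} → RightStep g a N → Profile h b K → RightStep (g ⊕ h) (a + b) (N + K)
    right-step-⊕ˡ (neutral p) q = neutral (profile-⊕ p q)

    right-step-⊕ʳ : ∀ {g h a b N K} → Profile g a N → RightStep h b K → RightStep (g ⊕ h) (a + b) (N + K)
    right-step-⊕ʳ {N = N} p (neutral {N = K} q) =
      subst (RightStep _ _) (sym (+-suc N K)) (neutral (profile-⊕ p q))

    unlock-⊕ : ∀ {g h a b N K} → Profile g a N → Profile h b K → ∀ {c} → a + b ≡ suc c →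
               Σ[ i ∈ Fin (nLeft (g ⊕ h)) ] Profile (leftOpt (g ⊕ h) i) c ((N + K) + m)
    unlock-⊕ {mk _ _ _ _} {mk _ _ _ _} {suc a} {b} {N} {K} (profile _ _ gUnlock _ _) ph refl =
      any-++ˡ (λ x → Profile x (a + b) ((N + K) + m)) _ _
              (map₂ (λ p → subst (Profile _ _) (+-swapʳ N m K) (profile-⊕ p ph)) (gUnlock refl))
    unlock-⊕ {mk _ _ _ _} {mk _ _ _ _} {zero} {suc b} {N} {K} pg (profile _ _ hUnlock _ _) refl =
      any-++ʳ (λ x → Profile x b ((N + K) + m)) _ _
              (map₂ (λ p → subst (Profile _ _) (sym (+-assoc N K m)) (profile-⊕ pg p)) (hUnlock refl))

    neutral-left-⊕ : ∀ {g h a b N K} → Profile g a N → Profile h b K → ∀ {N′} → N + K ≡ suc N′ →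
                     Σ[ i ∈ Fin (nLeft (g ⊕ h)) ] Profile (leftOpt (g ⊕ h) i) (a + b) N′
    neutral-left-⊕ {mk _ _ _ _} {mk _ _ _ _} {a} {b} {suc N} {K} (profile _ _ _ gNeutral _) ph refl =
      any-++ˡ (λ x → Profile x (a + b) (N + K)) _ _ (map₂ (λ p → profile-⊕ p ph) (gNeutral refl))
    neutral-left-⊕ {mk _ _ _ _} {mk _ _ _ _} {a} {b} {zero} {suc K} pg (profile _ _ _ hNeutral _) refl =
      any-++ʳ (λ x → Profile x (a + b) K) _ _ (map₂ (profile-⊕ pg) (hNeutral refl))

    neutral-right-⊕ : ∀ {g h a b N K} → Profile g a N → Profile h b K → ∀ {N′} → N + K ≡ suc N′ →
                      Σ[ i ∈ Fin (nRight (g ⊕ h)) ] Profile (rightOpt (g ⊕ h) i) (a + b) N′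
    neutral-right-⊕ {mk _ _ _ _} {mk _ _ _ _} {a} {b} {suc N} {K} (profile _ _ _ _ gNeutral) ph refl =
      any-++ˡ (λ x → Profile x (a + b) (N + K)) _ _ (map₂ (λ p → profile-⊕ p ph) (gNeutral refl))
    neutral-right-⊕ {mk _ _ _ _} {mk _ _ _ _} {a} {b} {zero} {suc K} pg (profile _ _ _ _ hNeutral) refl =
      any-++ʳ (λ x → Profile x (a + b) K) _ _ (map₂ (profile-⊕ pg) (hNeutral refl))

  no-left-option : ∀ {gL nR gR a N} → Profile (mk 0 gL nR gR) a N → a ≡ 0 × N ≡ 0
  no-left-option {a = zero} {zero} _ = refl , refl
  no-left-option {a = suc a} (profile _ _ unlocks _ _) with unlocks refl
  ... | () , _
  no-left-option {a = zero} {suc N} (profile _ _ _ neutrals _) with neutrals refl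
  ... | () , _

  no-right-option : ∀ {nL gL gR a N} → Profile (mk nL gL 0 gR) a N → N ≡ 0
  no-right-option {N = zero} _ = refl
  no-right-option {N = suc N} (profile _ _ _ _ neutrals) with neutrals refl
  ... | () , _

  right-options : ∀ {nL gL n gR a N} → Profile (mk nL gL (suc n) gR) a N →
                  Σ[ N′ ∈ ℕ ] N ≡ suc N′ × (∀ i → Profile (gR i) a N′)
  right-options {N = zero} (profile _ steps _ _ _) with steps Fin.zero
  ... | ()
  right-options {N = suc N} (profile _ steps _ _ _) = N , refl , λ i → right-step-profile (steps i)

  good-left-move : ∀ {nL gL nR gR a N} → Profile (mk nL gL nR gR) a N → Fin nL → even (len a N) ≡ true →
    Σ[ i ∈ Fin nL ] Σ[ a′ ∈ ℕ ] Σ[ N′ ∈ ℕ ]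
      Profile (gL i) a′ N′ × isZero N′ ≡ false × even (len a′ N′) ≡ false
  good-left-move {a = suc a} {N} (profile _ _ unlocks _ _) _ even-len with unlocks refl
  ... | i , p = i , a , N + m , p , cong isZero (+-suc N k)
              , not-injective (trans (cong even (sym (len-unlock a N))) even-len)
  good-left-move {a = zero} {zero} (profile steps _ _ _ _) i _ with steps i
  ... | ()
  good-left-move {a = zero} {suc zero} _ _ ()
  good-left-move {a = zero} {suc (suc N)} (profile _ _ _ neutrals _) _ even-len with neutrals refl
  ... | i , p = i , 0 , suc N , p , refl , not-injective even-len

  left-step-odd : ∀ {h a N} → LeftStep h a N → even (len a N) ≡ false →
                  Σ[ a′ ∈ ℕ ] Σ[ N′ ∈ ℕ ] Profile h a′ N′ × even (len a′ N′) ≡ true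
  left-step-odd s odd-len with left-step-length s
  ... | a′ , N′ , p , shorter = a′ , N′ , p , not-injective (trans (cong even (sym shorter)) odd-len)

  mutual
    left-first : ∀ {g a N} → Profile g a N → leftFirst g ≡ even (len a N)
    left-first {mk zero _ _ _} p with no-left-option p
    ... | refl , refl = refl
    left-first {mk (suc _) gL _ _} {a} {N} p@(profile steps _ _ _ _) with even (len a N) in parity
    ... | true =
      let (i , _ , _ , q , right-can-move , odd-len) = good-left-move p Fin.zero parity
      in anyF-intro _ (λ j → leftSecond (gL j)) i
                    (trans (left-second q) (cong₂ (λ x y → not x ∧ not y) right-can-move odd-len))
    ... | false = anyF-false _ _ λ i →
      let (_ , N′ , q , even-len) = left-step-odd (steps i) parity
      in trans (left-second q) (trans (cong (λ x → not (isZero N′) ∧ not x) even-len) (∧-zeroʳ _))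

    left-second : ∀ {g a N} → Profile g a N → leftSecond g ≡ not (isZero N) ∧ not (even (len a N))
    left-second {mk _ _ zero _} p with no-right-option p
    ... | refl = refl
    left-second {mk _ _ (suc n) _} {a} p with right-options p
    ... | N , refl , options = cong not (anyF-const n _ _ λ i →
      trans (cong not (left-first (options i))) (cong even (sym (len-neutral a N))))

    right-first : ∀ {g a N} → Profile g a N → rightFirst g ≡ isZero N ∨ even (len a N)
    right-first {mk _ _ zero _} p with no-right-option p
    ... | refl = refl
    right-first {mk _ _ (suc n) _} {a} p with right-options p
    ... | N , refl , options = anyF-const n _ _ λ i →
      trans (right-second (options i)) (cong even (sym (len-neutral a N)))

    right-second : ∀ {g a N} → Profile g a N → rightSecond g ≡ not (even (len a N))
    right-second {mk zero _ _ _} p with no-left-option p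
    ... | refl , refl = refl
    right-second {mk (suc _) gL _ _} {a} {N} p@(profile steps _ _ _ _) with even (len a N) in parity
    ... | true =
      let (i , _ , _ , q , right-can-move , odd-len) = good-left-move p Fin.zero parity
      in cong not (anyF-intro _ (λ j → not (rightFirst (gL j))) i
                               (cong not (trans (right-first q) (cong₂ _∨_ right-can-move odd-len))))
    ... | false = cong not (anyF-false _ _ λ i →
      let (_ , N′ , q , even-len) = left-step-odd (steps i) parity
      in cong not (trans (right-first q) (trans (cong (isZero N′ ∨_) even-len) (∨-zeroʳ _))))

  signature : ℕ → ℕ → Signature
  signature a N = even (len a N) , isZero N

  signature-⊕ : ∀ a b N K → signature (a + b) (N + K) ≡ signature a N ⊞ signature b K
  signature-⊕ a b N K =
    cong₂ _,_ (trans (cong even (len-⊕ a b N K)) (even-+ (len a N) (len b K))) (isZero-+ N K)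

  HasSignature : Game → Signature → Set
  HasSignature g s = Σ[ a ∈ ℕ ] Σ[ N ∈ ℕ ] Profile g a N × signature a N ≡ s

  outcome-signature : ∀ {g s} → HasSignature g s → outcome g ≡ canonicalOutcome s
  outcome-signature {g} (_ , _ , p , refl) =
    trans (outcome-decomposes g) (cong₂ outcomeOf (left-first p) (right-first p))

  has-signature-⊕ : ∀ {g h s t} → HasSignature g s → HasSignature h t → HasSignature (g ⊕ h) (s ⊞ t)
  has-signature-⊕ (a , N , p , refl) (b , K , q , refl) =
    a + b , N + K , profile-⊕ p q , signature-⊕ a b N K

  signed : ∀ {g a N} → Profile g a N → Σ[ s ∈ Signature ] HasSignature g s
  signed p = _ , _ , _ , p , refl

  closure-signature : ∀ {g} → Cl ξ g → Σ[ s ∈ Signature ] HasSignature g s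
  closure-signature base = signed profile-ξ
  closure-signature (sumC c d) =
    let (s , hs) = closure-signature c ; (t , ht) = closure-signature d in s ⊞ t , has-signature-⊕ hs ht
  closure-signature (leftC c i) with closure-signature c
  ... | _ , _ , _ , profile steps _ _ _ _ , _ = let (_ , _ , p , _) = left-step-length (steps i) in signed p
  closure-signature (rightC c i) with closure-signature c
  ... | _ , _ , _ , profile _ steps _ _ _ , _ with steps i
  ...   | neutral p = signed p

  same-signature⇒equiv : ∀ {g r s} → HasSignature g s → HasSignature r s → Equiv (Cl ξ) g r
  same-signature⇒equiv hg hr γ c =
    let (_ , hγ) = closure-signature c
    in trans (outcome-signature (has-signature-⊕ hg hγ)) (sym (outcome-signature (has-signature-⊕ hr hγ)))

  zero-signature : HasSignature zeroG (true , true)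
  zero-signature = 0 , 0 , profile-0 , refl

  star-signature : HasSignature star (false , false)
  star-signature = 0 , 1 , profile-tau 0 , refl

  star-star-signature : HasSignature (star ⊕ star) (true , false)
  star-star-signature = has-signature-⊕ star-signature star-signature

  -- * (hence 0) lies in cl(ξ): follow Left options ξ, τ^k, τ^(k-1), …, τ^0 = *.
  star-below-tau : ∀ j → Cl ξ (tau j) → Cl ξ star
  star-below-tau zero    c = c
  star-below-tau (suc j) c = star-below-tau j (leftC c Fin.zero)

  cl-star : Cl ξ star
  cl-star = star-below-tau k (leftC base Fin.zero)

  cl-zero : Cl ξ zeroG
  cl-zero = rightC cl-star Fin.zero

  -- For odd k the length k + 2 of ξ is odd, so ξ is a second probe besides 0.
  module OddExponent (k-odd : even k ≡ false) where

    ξ-signature : HasSignature ξ (false , true)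
    ξ-signature = 1 , 0 , profile-ξ , cong (_, true) ξ-odd
      where
      open ≡-Reasoning
      ξ-odd : even (len 1 0) ≡ false
      ξ-odd = begin
        even ((suc m + 0) + 0) ≡⟨ cong even (trans (+-identityʳ (suc m + 0)) (+-identityʳ (suc m))) ⟩
        not (not (even k))     ≡⟨ not-involutive (even k) ⟩
        even k                 ≡⟨ k-odd ⟩
        false                  ∎

    probe-signature : ∀ {g s} → HasSignature g s → decode (outcome (g ⊕ zeroG)) (outcome (g ⊕ ξ)) ≡ s
    probe-signature {s = s} hg =
      trans (cong₂ decode (outcome-signature (has-signature-⊕ hg zero-signature))
                          (outcome-signature (has-signature-⊕ hg ξ-signature)))
            (decode-probes s)

    separated : ∀ {g r s t} → HasSignature g s → HasSignature r t → s ≢ t → ¬ Equiv (Cl ξ) g r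
    separated hg hr s≢t g≡r = s≢t (begin
      _ ≡⟨ sym (probe-signature hg) ⟩
      _ ≡⟨ cong₂ decode (g≡r zeroG cl-zero) (g≡r ξ base) ⟩
      _ ≡⟨ probe-signature hr ⟩
      _ ∎)
      where open ≡-Reasoning

    classification : ∀ g → Cl ξ g →
      Equiv (Cl ξ) g zeroG ⊎ Equiv (Cl ξ) g star ⊎ Equiv (Cl ξ) g (star ⊕ star) ⊎ Equiv (Cl ξ) g ξ
    classification g c with closure-signature c
    ... | (true  , true)  , hg = inj₁ (same-signature⇒equiv hg zero-signature)
    ... | (false , false) , hg = inj₂ (inj₁ (same-signature⇒equiv hg star-signature))
    ... | (true  , false) , hg = inj₂ (inj₂ (inj₁ (same-signature⇒equiv hg star-star-signature)))
    ... | (false , true)  , hg = inj₂ (inj₂ (inj₂ (same-signature⇒equiv hg ξ-signature)))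

theorem3p4p6 : (n : ℕ) →
    let ξ = LG (tau (2 * n + 1)) in
    (Cl ξ zeroG × Cl ξ star × Cl ξ (star ⊕ star) × Cl ξ ξ)
    × (¬ Equiv (Cl ξ) zeroG star × ¬ Equiv (Cl ξ) zeroG (star ⊕ star) × ¬ Equiv (Cl ξ) zeroG ξ
       × ¬ Equiv (Cl ξ) star (star ⊕ star) × ¬ Equiv (Cl ξ) star ξ × ¬ Equiv (Cl ξ) (star ⊕ star) ξ)
    × (∀ g → Cl ξ g →
         Equiv (Cl ξ) g zeroG ⊎ Equiv (Cl ξ) g star ⊎ Equiv (Cl ξ) g (star ⊕ star) ⊎ Equiv (Cl ξ) g ξ)
theorem3p4p6 n =
    (cl-zero , cl-star , sumC cl-star cl-star , base)
  , ( separated zero-signature star-signature (λ ())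
    , separated zero-signature star-star-signature (λ ())
    , separated zero-signature ξ-signature (λ ())
    , separated star-signature star-star-signature (λ ())
    , separated star-signature ξ-signature (λ ())
    , separated star-star-signature ξ-signature (λ ()))
  , classification
  where
  open CanonicalForm (2 * n + 1)
  open OddExponent (even-2n+1 n)
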